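{- For every nonzero $\mu\in\widetilde{\mathcal E}$, $R\big(\sum\mu\widetilde H\big)=R\big(\sum\bar\mu\widetilde H\big)$.
   Context: A coefficient function is a sequence $\mu=(\mu_1,\mu_2,\dots)$ of non-negative integers; it has finite support if only finitely many $\mu_k$ are nonzero. For a sequence $G$, $\sum\mu G:=\sum_{k\ge1}\mu_kG_k$. For $n\ge1$, $\mathrm{rev}_n(\mu)=(\mu_n,\mu_{n-1},\dots,\mu_1,0,0,\dots)$. For finite-support $\mu\ne\mu'$, $\mu<_a\mu'$ means $\mu_k<\mu'_k$ for the largest $k$ with $\mu_k\ne\mu'_k$. For a list $L=(e_1,\dots,e_N)$ of non-negative integers with $N\ge2$, $e_1\ne0$, let $\beta^*$ be the coefficient function with $\beta^*_k=e_j$ whenever $k\equiv j\pmod N$, $1\le j\le N$; for $n\ge2$ let $\theta^n=\mathrm{rev}_{n-1}(\beta^*)$ (the maximal $L$-block at index $n-1$, support interval $[1,n-1]$). A proper $L$-block at index $n-1$ ($n\ge2$) is a coefficient function $\zeta$ such that for some $k\in[1,n-1]$: $\zeta_j=\theta^n_j$ for $j>k$, $\zeta_k<\theta^n_k$, $\zeta_j=0$ for $j<k$; its support interval is $[k,n-1]$. The periodic Zeckendorf collection for positive integers determined by $L$ is the set of all finite sums (including $0$) of $L$-blocks with pairwise disjoint support intervals. Its fundamental sequence $H$ is given by $H_1=1$, $H_n=1+\sum\theta^nH$ ($n\ge2$); $\epsilon\mapsto\sum\epsilon H$ is a bijection from the collection onto $\mathbb Z_{\ge0}$, strictly increasing for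 $<_a$. Let $\mathcal E\subsetneq\widetilde{\mathcal E}$ be the periodic Zeckendorf collections for positive integers determined by two such lists $L,\widetilde L$, and let $\widetilde H$ be the fundamental sequence of $\widetilde{\mathcal E}$. For a positive integer $x$, $R(x)$ is the set of non-negative integers of the form $\sum\epsilon\widetilde H<x$ with $\epsilon\in\mathcal E$. For nonzero finite-support $\mu$, $\check\mu$ is the $<_a$-largest element of $\mathcal E$ that is $<_a\mu$, and $\bar\mu$ is the $<_a$-smallest element of $\mathcal E$ that is $>_a\check\mu$. -}

module Defs where

open import Data.Nat using (ℕ; zero; suc; _+_; _*_; _∸_; _≤_; _<_; _≤?_)
open import Data.Nat.DivMod using (_%_)
open import Data.List using (List; []; _∷_; length; map)
open import Data.Nat.ListAction using (sum)
open import Data.List.Relation.Unary.AllPairs using (AllPairs)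
open import Data.Product using (Σ; _×_; _,_)
open import Data.Sum using (_⊎_)
open import Relation.Nullary using (¬_; yes; no)
open import Relation.Binary.PropositionalEquality using (_≡_; _≢_)

-- A coefficient function μ = (μ₁, μ₂, …) is a function ℕ → ℕ where the
-- argument k ≥ 1 gives μ_k; the value at 0 is junk and is never used
-- (all blocks, hence all elements of a collection, vanish at 0).
Coef : Set
Coef = ℕ → ℕ

record FCoef : Set where
  constructor fcoef
  field
    fn     : Coef
    bound  : ℕ
    vanish : ∀ k → bound < k → fn k ≡ 0
open FCoef public

sumTo : ℕ → Coef → (ℕ → ℕ) → ℕ
sumTo zero    μ G = 0
sumTo (suc B) μ G = sumTo B μ G + μ (suc B) * G (suc B)

wsum : FCoef → (ℕ → ℕ) → ℕ
wsum μ G = sumTo (bound μ) (fn μ) G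

NonZeroCoef : Coef → Set
NonZeroCoef μ = Σ ℕ λ k → 1 ≤ k × μ k ≢ 0

_<a_ : Coef → Coef → Set
μ <a μ' = Σ ℕ λ k → 1 ≤ k × μ k < μ' k × (∀ j → k < j → μ j ≡ μ' j)

_≈c_ : Coef → Coef → Set
μ ≈c μ' = ∀ k → 1 ≤ k → μ k ≡ μ' k

_≤a_ : Coef → Coef → Set
μ ≤a μ' = μ <a μ' ⊎ μ ≈c μ'

rev : ℕ → Coef → Coef
rev n μ j with 1 ≤? j | j ≤? n
... | yes _ | yes _ = μ (suc n ∸ j)
... | _     | _     = 0

at : List ℕ → ℕ → ℕ
at []       _       = 0
at (x ∷ xs) zero    = x
at (x ∷ xs) (suc i) = at xs i

-- A list L = (e₁, …, e_N) with N ≥ 2 and e₁ ≠ 0, given as e₁ ∷ rest.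
record ZList : Set where
  constructor zlist
  field
    e₁      : ℕ
    rest    : List ℕ
    e₁≢0    : e₁ ≢ 0
    rest≥1  : 1 ≤ length rest
open ZList public

elems : ZList → List ℕ
elems Z = e₁ Z ∷ rest Z

-- β*_k = e_j  where k ≡ j (mod N), 1 ≤ j ≤ N   (for k ≥ 1)
beta* : ZList → Coef
beta* Z k = at (elems Z) ((k ∸ 1) % suc (length (rest Z)))

theta : ZList → ℕ → Coef
theta Z n = rev (n ∸ 1) (beta* Z)

-- IsBlock Z m lo ζ : ζ is an L-block at index m = n-1 (m ≥ 1, n = m+1)
-- with support interval [lo, m]
data IsBlock (Z : ZList) (m : ℕ) : ℕ → Coef → Set where
  maximal : (ζ : Coef) → 1 ≤ m → (∀ j → ζ j ≡ theta Z (suc m) j) →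
            IsBlock Z m 1 ζ
  proper  : (ζ : Coef) (k : ℕ) → 1 ≤ k → k ≤ m →
            (∀ j → k < j → ζ j ≡ theta Z (suc m) j) →
            ζ k < theta Z (suc m) k →
            (∀ j → j < k → ζ j ≡ 0) →
            IsBlock Z m k ζ

record Block (Z : ZList) : Set where
  constructor block
  field
    idx     : ℕ
    lo      : ℕ
    bfn     : Coef
    isBlock : IsBlock Z idx lo bfn
open Block public

DisjointSupp : {Z : ZList} → Block Z → Block Z → Set
DisjointSupp b b' = idx b < lo b' ⊎ idx b' < lo b

InColl : ZList → Coef → Set
InColl Z μ = Σ (List (Block Z)) λ bs →
  AllPairs DisjointSupp bs × (∀ j → μ j ≡ sum (map (λ b → bfn b j) bs))

-- H is the fundamental sequence of the collection determined by Z: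
-- H₁ = 1, H_n = 1 + Σ θ^n H  (n ≥ 2)   (H 0 is unused junk)
IsFundSeq : ZList → (ℕ → ℕ) → Set
IsFundSeq Z H = H 1 ≡ 1 × (∀ n → 2 ≤ n → H n ≡ 1 + sumTo (n ∸ 1) (theta Z n) H)

InR : ZList → (ℕ → ℕ) → ℕ → ℕ → Set
InR Z H̃ x y = Σ FCoef λ ε → InColl Z (fn ε) × y ≡ wsum ε H̃ × y < x

IsCheck : ZList → Coef → Coef → Set
IsCheck Z μ c = InColl Z c × c <a μ ×
  (∀ (ε : FCoef) → InColl Z (fn ε) → fn ε <a μ → fn ε ≤a c)

IsBar : ZList → Coef → Coef → Set
IsBar Z c b = InColl Z b × c <a b ×
  (∀ (ε : FCoef) → InColl Z (fn ε) → c <a fn ε → b ≤a fn ε)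

{-# OPTIONS --safe #-}
-- Evaluation ε ↦ Σ ε H is strictly <_a-increasing on a periodic Zeckendorf
-- collection.  Decompose an element into blocks in decreasing position: an
-- element supported below n evaluates to less than H_n, because
-- H_n = 1 + Σ θ^n H and a proper block is dominated by the maximal one; two
-- such decompositions are then compared block by block from the top.
-- Applied to ℰ̃ ⊇ ℰ, R(Σ ν H̃) is the evaluation of {ε ∈ ℰ : ε <_a ν}, and for
-- ε ∈ ℰ one has ε <_a μ ⇔ ε ≤_a μ̌ ⇔ ε <_a μ̄.
module Submission where

open import Defs
open import Data.Empty using (⊥; ⊥-elim)
open import Data.List using (List; []; _∷_; map)
open import Data.List.Relation.Binary.Subset.Propositional using (_⊆_)
open import Data.List.Relation.Binary.Subset.Propositional.Properties using (xs⊆x∷xs; ∷⁺ʳ; ⊆-trans)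
open import Data.List.Relation.Unary.All as All using (All; []; _∷_)
open import Data.List.Relation.Unary.AllPairs using (AllPairs; []; _∷_)
open import Data.List.Relation.Unary.Any using (here; there)
open import Data.Nat using (ℕ; zero; suc; _+_; _*_; _⊔_; _≤_; _<_; _≤?_; _≟_; _∸_; z≤n; s≤s)
open import Data.Nat.ListAction using (sum)
open import Data.Nat.Properties
open import Algebra.Properties.CommutativeSemigroup +-commutativeSemigroup
  using (interchange; xy∙z≈xz∙y; x∙yz≈y∙xz)
open import Data.Product using (Σ; _×_; _,_; proj₁; proj₂)
open import Data.Sum using (_⊎_; inj₁; inj₂)
open import Relation.Binary using (tri<; tri≈; tri>)
open import Relation.Binary.PropositionalEquality
open import Relation.Nullary using (¬_; yes; no)

module WeightedSums (H : ℕ → ℕ) where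

  sumTo-cong : ∀ n {f g : Coef} → (∀ j → 1 ≤ j → j ≤ n → f j ≡ g j) →
               sumTo n f H ≡ sumTo n g H
  sumTo-cong zero    f≡g = refl
  sumTo-cong (suc n) f≡g =
    cong₂ _+_ (sumTo-cong n (λ j j≥1 j≤n → f≡g j j≥1 (m≤n⇒m≤1+n j≤n)))
              (cong (_* H (suc n)) (f≡g (suc n) (s≤s z≤n) ≤-refl))

  sumTo-mono : ∀ n {f g : Coef} → (∀ j → 1 ≤ j → j ≤ n → f j ≤ g j) →
               sumTo n f H ≤ sumTo n g H
  sumTo-mono zero    f≤g = z≤n
  sumTo-mono (suc n) f≤g =
    +-mono-≤ (sumTo-mono n (λ j j≥1 j≤n → f≤g j j≥1 (m≤n⇒m≤1+n j≤n)))
             (*-monoˡ-≤ (H (suc n)) (f≤g (suc n) (s≤s z≤n) ≤-refl))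

  sumTo-+ : ∀ n (f g : Coef) →
            sumTo n (λ j → f j + g j) H ≡ sumTo n f H + sumTo n g H
  sumTo-+ zero    f g = refl
  sumTo-+ (suc n) f g = begin
    sumTo n (λ j → f j + g j) H + (f (suc n) + g (suc n)) * H (suc n)
      ≡⟨ cong₂ _+_ (sumTo-+ n f g) (*-distribʳ-+ (H (suc n)) (f (suc n)) (g (suc n))) ⟩
    sumTo n f H + sumTo n g H + (f (suc n) * H (suc n) + g (suc n) * H (suc n))
      ≡⟨ interchange (sumTo n f H) (sumTo n g H) _ _ ⟩
    sumTo n f H + f (suc n) * H (suc n) + (sumTo n g H + g (suc n) * H (suc n)) ∎
    where open ≡-Reasoning

  sumTo-zero : ∀ n {f : Coef} → (∀ j → 1 ≤ j → j ≤ n → f j ≡ 0) → sumTo n f H ≡ 0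
  sumTo-zero zero    f≡0 = refl
  sumTo-zero (suc n) f≡0 rewrite f≡0 (suc n) (s≤s z≤n) ≤-refl =
    trans (+-identityʳ _) (sumTo-zero n (λ j j≥1 j≤n → f≡0 j j≥1 (m≤n⇒m≤1+n j≤n)))

  sumTo-truncate : ∀ {m} n (f : Coef) → m ≤ n → (∀ j → m < j → f j ≡ 0) →
                   sumTo n f H ≡ sumTo m f H
  sumTo-truncate zero    f z≤n f≡0 = refl
  sumTo-truncate (suc n) f m≤1+n f≡0 with m≤n⇒m<n∨m≡n m≤1+n
  ... | inj₂ refl = refl
  ... | inj₁ (s≤s m≤n) rewrite f≡0 (suc n) (s≤s m≤n) =
    trans (+-identityʳ _) (sumTo-truncate n f m≤n f≡0)

  term≤sumTo : ∀ n (f : Coef) {j} → 1 ≤ j → j ≤ n → f j * H j ≤ sumTo n f H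
  term≤sumTo zero    f j≥1 j≤0 = ⊥-elim (<⇒≱ j≥1 j≤0)
  term≤sumTo (suc n) f j≥1 j≤1+n with m≤n⇒m<n∨m≡n j≤1+n
  ... | inj₂ refl      = m≤n+m _ _
  ... | inj₁ (s≤s j≤n) = ≤-trans (term≤sumTo n f j≥1 j≤n) (m≤m+n _ _)

  sumTo-+H≤ : ∀ n {f g : Coef} {l} → 1 ≤ l → l ≤ n →
              (∀ j → 1 ≤ j → j ≤ n → f j ≤ g j) → f l < g l →
              sumTo n f H + H l ≤ sumTo n g H
  sumTo-+H≤ zero    l≥1 l≤0 f≤g fl<gl = ⊥-elim (<⇒≱ l≥1 l≤0)
  sumTo-+H≤ (suc n) {f} {g} {l} l≥1 l≤1+n f≤g fl<gl with m≤n⇒m<n∨m≡n l≤1+n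
  ... | inj₂ refl = begin
    sumTo n f H + f l * H l + H l    ≡⟨ +-assoc (sumTo n f H) _ _ ⟩
    sumTo n f H + (f l * H l + H l)  ≡⟨ cong (sumTo n f H +_) (+-comm (f l * H l) (H l)) ⟩
    sumTo n f H + suc (f l) * H l    ≤⟨ +-mono-≤ (sumTo-mono n f≤g′) (*-monoˡ-≤ (H l) fl<gl) ⟩
    sumTo n g H + g l * H l          ∎
    where
    open ≤-Reasoning
    f≤g′ : ∀ j → 1 ≤ j → j ≤ n → f j ≤ g j
    f≤g′ j j≥1 j≤n = f≤g j j≥1 (m≤n⇒m≤1+n j≤n)
  ... | inj₁ (s≤s l≤n) = begin
    sumTo n f H + f (suc n) * H (suc n) + H l  ≡⟨ xy∙z≈xz∙y (sumTo n f H) _ _ ⟩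
    sumTo n f H + H l + f (suc n) * H (suc n)
      ≤⟨ +-mono-≤ (sumTo-+H≤ n l≥1 l≤n f≤g′ fl<gl)
                  (*-monoˡ-≤ (H (suc n)) (f≤g (suc n) (s≤s z≤n) ≤-refl)) ⟩
    sumTo n g H + g (suc n) * H (suc n)        ∎
    where
    open ≤-Reasoning
    f≤g′ : ∀ j → 1 ≤ j → j ≤ n → f j ≤ g j
    f≤g′ j j≥1 j≤n = f≤g j j≥1 (m≤n⇒m≤1+n j≤n)

rev-above : ∀ n (f : Coef) j → n < j → rev n f j ≡ 0
rev-above n f j n<j with 1 ≤? j | j ≤? n
... | yes _ | yes j≤n = ⊥-elim (<⇒≱ n<j j≤n)
... | yes _ | no _    = refl
... | no _  | _       = refl

rev-zero : ∀ n (f : Coef) → rev n f 0 ≡ 0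
rev-zero n f with 1 ≤? 0
... | no _ = refl

rev-in : ∀ n (f : Coef) j → 1 ≤ j → j ≤ n → rev n f j ≡ f (suc n ∸ j)
rev-in n f j j≥1 j≤n with 1 ≤? j | j ≤? n
... | yes _ | yes _    = refl
... | yes _ | no j≰n   = ⊥-elim (j≰n j≤n)
... | no j≱1 | _       = ⊥-elim (j≱1 j≥1)

<a-irrefl : ∀ {f : Coef} → ¬ (f <a f)
<a-irrefl (_ , _ , fk<fk , _) = <-irrefl refl fk<fk

<a-trans : ∀ {f g h : Coef} → f <a g → g <a h → f <a h
<a-trans {f} {g} {h} (k₁ , k₁≥1 , fk<gk , f≡g) (k₂ , k₂≥1 , gk<hk , g≡h) with <-cmp k₁ k₂
... | tri< k₁<k₂ _ _ = k₂ , k₂≥1 , subst (_< h k₂) (sym (f≡g k₂ k₁<k₂)) gk<hk ,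
                       λ j k₂<j → trans (f≡g j (<-trans k₁<k₂ k₂<j)) (g≡h j k₂<j)
... | tri≈ _ refl _  = k₁ , k₁≥1 , <-trans fk<gk gk<hk , λ j k<j → trans (f≡g j k<j) (g≡h j k<j)
... | tri> _ _ k₂<k₁ = k₁ , k₁≥1 , subst (f k₁ <_) (g≡h k₁ k₂<k₁) fk<gk ,
                       λ j k₁<j → trans (f≡g j k₁<j) (g≡h j (<-trans k₂<k₁ k₁<j))

<a-respˡ-≈c : ∀ {f g h : Coef} → f ≈c g → g <a h → f <a h
<a-respˡ-≈c {h = h} f≈g (k , k≥1 , gk<hk , g≡h) =
  k , k≥1 , subst (_< h k) (sym (f≈g k k≥1)) gk<hk ,
  λ j k<j → trans (f≈g j (≤-trans k≥1 (<⇒≤ k<j))) (g≡h j k<j)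

≤a-<a-trans : ∀ {f g h : Coef} → f ≤a g → g <a h → f <a h
≤a-<a-trans (inj₁ f<g) g<h = <a-trans f<g g<h
≤a-<a-trans (inj₂ f≈g) g<h = <a-respˡ-≈c f≈g g<h

<a-resp-≗ : ∀ {f f′ g g′ : Coef} → f ≗ f′ → g ≗ g′ → f <a g → f′ <a g′
<a-resp-≗ f≗f′ g≗g′ (k , k≥1 , fk<gk , f≡g) =
  k , k≥1 , subst₂ _<_ (f≗f′ k) (g≗g′ k) fk<gk ,
  λ j k<j → trans (sym (f≗f′ j)) (trans (f≡g j k<j) (g≗g′ j))

<a-cancelˡ-+ : ∀ {h h′ f g : Coef} → h ≗ h′ →
               (λ j → h j + f j) <a (λ j → h′ j + g j) → f <a g
<a-cancelˡ-+ {h} h≗h′ (k , k≥1 , lt , eq) =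
  k , k≥1 , +-cancelˡ-< (h k) _ _ (subst (λ x → h k + _ < x + _) (sym (h≗h′ k)) lt) ,
  λ j k<j → +-cancelˡ-≡ (h j) _ _ (trans (eq j k<j) (cong (_+ _) (sym (h≗h′ j))))

≥-from⇒≮a : ∀ {f g : Coef} {l} → (∀ j → l ≤ j → g j ≤ f j) → g l < f l → ¬ (f <a g)
≥-from⇒≮a {l = l} g≤f gl<fl (k , _ , fk<gk , f≡g) with <-cmp k l
... | tri< k<l _ _ = <-irrefl (sym (f≡g l k<l)) gl<fl
... | tri≈ _ refl _ = <-asym fk<gk gl<fl
... | tri> _ _ l<k  = <⇒≱ fk<gk (g≤f k (<⇒≤ l<k))

vanish-from⇒≮a : ∀ {f g : Coef} {l} → (∀ j → l ≤ j → g j ≡ 0) → 1 ≤ f l → ¬ (f <a g)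
vanish-from⇒≮a {f} {l = l} g≡0 fl≥1 =
  ≥-from⇒≮a (λ j l≤j → subst (_≤ f j) (sym (g≡0 j l≤j)) z≤n) (subst (_< f l) (sym (g≡0 l ≤-refl)) fl≥1)

<a-trichotomy : ∀ n (f g : Coef) → (∀ j → n < j → f j ≡ g j) → f <a g ⊎ f ≈c g ⊎ g <a f
<a-trichotomy zero    f g f≡g = inj₂ (inj₁ f≡g)
<a-trichotomy (suc n) f g f≡g with <-cmp (f (suc n)) (g (suc n))
... | tri< lt _ _ = inj₁ (suc n , s≤s z≤n , lt , f≡g)
... | tri> _ _ gt = inj₂ (inj₂ (suc n , s≤s z≤n , gt , λ j n<j → sym (f≡g j n<j)))
... | tri≈ _ eq _ = <a-trichotomy n f g f≡g′
  where
  f≡g′ : ∀ j → n < j → f j ≡ g j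
  f≡g′ j n<j with m≤n⇒m<n∨m≡n n<j
  ... | inj₁ 1+n<j = f≡g j 1+n<j
  ... | inj₂ refl  = eq

<a-trichotomy-finite : (ε μ : FCoef) → fn ε <a fn μ ⊎ fn ε ≈c fn μ ⊎ fn μ <a fn ε
<a-trichotomy-finite ε μ = <a-trichotomy (bound ε + bound μ) (fn ε) (fn μ) λ j j> →
  trans (vanish ε j (≤-<-trans (m≤m+n _ _) j>)) (sym (vanish μ j (≤-<-trans (m≤n+m _ _) j>)))

Dominated : Coef → ℕ → Coef → Set
Dominated ζ l ξ = (∀ j → ζ j ≤ ξ j) × ζ l < ξ l

Dominated-+ʳ : ∀ {ζ l ξ} (ε : Coef) → Dominated ζ l ξ → Dominated ζ l (λ j → ξ j + ε j)
Dominated-+ʳ ε (ζ≤ξ , ζl<ξl) = (λ j → ≤-trans (ζ≤ξ j) (m≤m+n _ _)) , ≤-trans ζl<ξl (m≤m+n _ _)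

Dominated⇒≮a : ∀ {ξ l ζ} (ε : Coef) {μ : Coef} → Dominated ξ l ζ → (∀ j → l ≤ j → μ j ≡ 0) →
               ¬ ((λ j → ζ j + ε j) <a (λ j → ξ j + μ j))
Dominated⇒≮a {ξ} {l} {ζ} ε {μ} ξ≺ζ μ≡0 =
  ≥-from⇒≮a (λ j l≤j → subst (_≤ _) (sym (ξ+μ≡ξ j l≤j)) (proj₁ ξ≺ζ+ε j))
             (subst (_< _) (sym (ξ+μ≡ξ l ≤-refl)) (proj₂ ξ≺ζ+ε))
  where
  ξ≺ζ+ε : Dominated ξ l (λ j → ζ j + ε j)
  ξ≺ζ+ε = Dominated-+ʳ ε ξ≺ζ
  ξ+μ≡ξ : ∀ j → l ≤ j → ξ j + μ j ≡ ξ j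
  ξ+μ≡ξ j l≤j = trans (cong (ξ j +_) (μ≡0 j l≤j)) (+-identityʳ _)

module Blocks (Z : ZList) where

  -- θ m is the paper's θ^{m+1}, the maximal block at index m.
  θ : ℕ → Coef
  θ m = theta Z (suc m)

  θ-top : ∀ {m} → 1 ≤ m → θ m m ≡ e₁ Z
  θ-top {m} m≥1 = trans (rev-in m (beta* Z) m m≥1 ≤-refl) (cong (beta* Z) (m+n∸n≡m 1 m))

  θ-isBlock : ∀ {m} → 1 ≤ m → IsBlock Z m 1 (θ m)
  θ-isBlock m≥1 = maximal _ m≥1 (λ _ → refl)

  module _ {m l : ℕ} {ζ : Coef} where

    block-lo≥1 : IsBlock Z m l ζ → 1 ≤ l
    block-lo≥1 (maximal _ _ _)          = s≤s z≤n
    block-lo≥1 (proper _ _ k≥1 _ _ _ _) = k≥1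

    block-lo≤idx : IsBlock Z m l ζ → l ≤ m
    block-lo≤idx (maximal _ m≥1 _)        = m≥1
    block-lo≤idx (proper _ _ _ k≤m _ _ _) = k≤m

    block-idx≥1 : IsBlock Z m l ζ → 1 ≤ m
    block-idx≥1 ib = ≤-trans (block-lo≥1 ib) (block-lo≤idx ib)

    block-above-lo : IsBlock Z m l ζ → ∀ j → l < j → ζ j ≡ θ m j
    block-above-lo (maximal _ _ ζ≡θ)          j _ = ζ≡θ j
    block-above-lo (proper _ _ _ _ ζ≡θ _ _) = ζ≡θ

    block-below-lo : IsBlock Z m l ζ → ∀ j → j < l → ζ j ≡ 0
    block-below-lo (maximal _ _ ζ≡θ) zero    _         = trans (ζ≡θ 0) (rev-zero m (beta* Z))
    block-below-lo (maximal _ _ _)   (suc j) (s≤s ())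
    block-below-lo (proper _ _ _ _ _ _ ζ≡0) = ζ≡0

    block-lo<θ : IsBlock Z m l ζ → 2 ≤ l → ζ l < θ m l
    block-lo<θ (maximal _ _ _)            (s≤s ())
    block-lo<θ (proper _ _ _ _ _ ζk<θk _) _ = ζk<θk

    block-above-idx : IsBlock Z m l ζ → ∀ j → m < j → ζ j ≡ 0
    block-above-idx ib j m<j = trans (block-above-lo ib j (≤-<-trans (block-lo≤idx ib) m<j))
                                     (rev-above m (beta* Z) j m<j)

    -- A block with a zero leading coefficient is proper at its own index,
    -- since otherwise that coefficient would be e₁ ≠ 0.
    block-top≡0 : IsBlock Z m l ζ → ζ m ≡ 0 → ∀ j → ζ j ≡ 0
    block-top≡0 ib ζm≡0 j with m≤n⇒m<n∨m≡n (block-lo≤idx ib)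
    ... | inj₁ l<m = ⊥-elim (e₁≢0 Z (trans (sym (θ-top (block-idx≥1 ib)))
                                           (trans (sym (block-above-lo ib m l<m)) ζm≡0)))
    ... | inj₂ refl with <-cmp j l
    ...   | tri< j<l _ _ = block-below-lo ib j j<l
    ...   | tri≈ _ refl _ = ζm≡0
    ...   | tri> _ _ l<j = block-above-idx ib j l<j

  block-dominated : ∀ {m l l′ ζ ξ} → IsBlock Z m l ζ → IsBlock Z m l′ ξ →
                    l ≤ l′ → ξ l′ < ζ l′ → Dominated ξ l′ ζ
  block-dominated {l′ = l′} {ζ} {ξ} ib ib′ l≤l′ ξl′<ζl′ = ξ≤ζ , ξl′<ζl′
    where
    ξ≤ζ : ∀ j → ξ j ≤ ζ j
    ξ≤ζ j with <-cmp j l′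
    ... | tri< j<l′ _ _ = ≤-trans (≤-reflexive (block-below-lo ib′ j j<l′)) z≤n
    ... | tri≈ _ refl _ = <⇒≤ ξl′<ζl′
    ... | tri> _ _ l′<j = ≤-reflexive (trans (block-above-lo ib′ j l′<j)
                                             (sym (block-above-lo ib j (≤-<-trans l≤l′ l′<j))))

  blocks-compare : ∀ {m l l′ ζ ξ} → IsBlock Z m l ζ → IsBlock Z m l′ ξ →
                   (l ≡ l′ × ζ ≗ ξ) ⊎ Dominated ζ l ξ ⊎ Dominated ξ l′ ζ
  blocks-compare {l = l} {l′} {ζ} {ξ} ib ib′ with <-cmp l l′
  ... | tri< l<l′ _ _ = inj₂ (inj₂ (block-dominated ib ib′ (<⇒≤ l<l′)
          (subst (ξ l′ <_) (sym (block-above-lo ib l′ l<l′))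
                 (block-lo<θ ib′ (≤-trans (s≤s (block-lo≥1 ib)) l<l′)))))
  ... | tri> _ _ l′<l = inj₂ (inj₁ (block-dominated ib′ ib (<⇒≤ l′<l)
          (subst (ζ l <_) (sym (block-above-lo ib′ l l′<l))
                 (block-lo<θ ib (≤-trans (s≤s (block-lo≥1 ib′)) l′<l)))))
  ... | tri≈ _ refl _ with <-cmp (ζ l) (ξ l)
  ...   | tri< ζl<ξl _ _ = inj₂ (inj₁ (block-dominated ib′ ib ≤-refl ζl<ξl))
  ...   | tri> _ _ ξl<ζl = inj₂ (inj₂ (block-dominated ib ib′ ≤-refl ξl<ζl))
  ...   | tri≈ _ ζl≡ξl _ = inj₁ (refl , ζ≗ξ)
    where
    ζ≗ξ : ζ ≗ ξ
    ζ≗ξ j with <-cmp j l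
    ... | tri< j<l _ _ = trans (block-below-lo ib j j<l) (sym (block-below-lo ib′ j j<l))
    ... | tri≈ _ refl _ = ζl≡ξl
    ... | tri> _ _ l<j = trans (block-above-lo ib j l<j) (sym (block-above-lo ib′ j l<j))

module DescendingBlocks (Z : ZList) where
  open Blocks Z

  Σblocks : List (Block Z) → Coef
  Σblocks bs j = sum (map (λ b → bfn b j) bs)

  data Descending (n : ℕ) : List (Block Z) → Set where
    []   : Descending n []
    cons : ∀ {b bs} → idx b < n → 1 ≤ bfn b (idx b) → Descending (lo b) bs →
           Descending n (b ∷ bs)

  Descending-vanish : ∀ {n bs} → Descending n bs → ∀ j → n ≤ j → Σblocks bs j ≡ 0
  Descending-vanish []                 j _   = refl
  Descending-vanish (cons {b} b<n _ d) j n≤j =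
    cong₂ _+_ (block-above-idx (isBlock b) j b<j)
              (Descending-vanish d j (≤-trans (block-lo≤idx (isBlock b)) (<⇒≤ b<j)))
    where
    b<j : idx b < j
    b<j = <-≤-trans b<n n≤j

  Descending-weaken : ∀ {n n′ bs} → n ≤ n′ → Descending n bs → Descending n′ bs
  Descending-weaken n≤n′ []                = []
  Descending-weaken n≤n′ (cons b<n b≢0 d) = cons (<-≤-trans b<n n≤n′) b≢0 d

  insert : (b : Block Z) (bs : List (Block Z)) → All (DisjointSupp b) bs → List (Block Z)
  insert b []       []                = b ∷ []
  insert b (c ∷ cs) (inj₁ b<c ∷ b#cs) = c ∷ insert b cs b#cs
  insert b (c ∷ cs) (inj₂ c<b ∷ _)    = b ∷ c ∷ cs

  Σblocks-insert : ∀ b bs (b#bs : All (DisjointSupp b) bs) j →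
                   Σblocks (insert b bs b#bs) j ≡ bfn b j + Σblocks bs j
  Σblocks-insert b []       []                j = refl
  Σblocks-insert b (c ∷ cs) (inj₁ _ ∷ b#cs) j =
    trans (cong (bfn c j +_) (Σblocks-insert b cs b#cs j)) (x∙yz≈y∙xz (bfn c j) (bfn b j) (Σblocks cs j))
  Σblocks-insert b (c ∷ cs) (inj₂ _ ∷ _)    j = refl

  insert-⊆ : ∀ b bs (b#bs : All (DisjointSupp b) bs) → insert b bs b#bs ⊆ b ∷ bs
  insert-⊆ b []       []                x∈ = x∈
  insert-⊆ b (c ∷ cs) (inj₂ _ ∷ _)    x∈ = x∈
  insert-⊆ b (c ∷ cs) (inj₁ _ ∷ b#cs) (here refl) = there (here refl)
  insert-⊆ b (c ∷ cs) (inj₁ _ ∷ b#cs) (there x∈) with insert-⊆ b cs b#cs x∈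
  ... | here x≡b  = here x≡b
  ... | there x∈cs = there (there x∈cs)

  insert-Descending : ∀ {n b bs} (b#bs : All (DisjointSupp b) bs) → idx b < n →
                      1 ≤ bfn b (idx b) → Descending n bs → Descending n (insert b bs b#bs)
  insert-Descending []                b<n b≢0 []                 = cons b<n b≢0 []
  insert-Descending (inj₁ b<c ∷ b#cs) b<n b≢0 (cons c<n c≢0 dc) =
    cons c<n c≢0 (insert-Descending b#cs b<c b≢0 dc)
  insert-Descending (inj₂ c<b ∷ _)    b<n b≢0 (cons _ c≢0 dc)   =
    cons b<n b≢0 (cons c<b c≢0 dc)

  sortBlocks : ∀ bs → AllPairs DisjointSupp bs →
               Σ ℕ λ n → Σ (List (Block Z)) λ ds →
               Descending n ds × (∀ j → Σblocks ds j ≡ Σblocks bs j) × ds ⊆ bs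
  sortBlocks [] [] = 0 , [] , [] , (λ _ → refl) , λ x∈ → x∈
  sortBlocks (b ∷ bs) (b#bs ∷ disjoint) with sortBlocks bs disjoint
  ... | n , ds , d , ds≗bs , ds⊆bs with bfn b (idx b) ≟ 0
  ...   | yes b-top≡0 =
    n , ds , d , (λ j → trans (ds≗bs j) (cong (_+ Σblocks bs j) (sym (block-top≡0 (isBlock b) b-top≡0 j)))) ,
    ⊆-trans ds⊆bs (xs⊆x∷xs bs b)
  ...   | no b-top≢0 =
    n ⊔ suc (idx b) , insert b ds b#ds ,
    insert-Descending b#ds (m≤n⊔m n _) (n≢0⇒n>0 b-top≢0) (Descending-weaken (m≤m⊔n n _) d) ,
    (λ j → trans (Σblocks-insert b ds b#ds j) (cong (bfn b j +_) (ds≗bs j))) ,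
    ⊆-trans (insert-⊆ b ds b#ds) (∷⁺ʳ b ds⊆bs)
    where
    b#ds : All (DisjointSupp b) ds
    b#ds = All.tabulate λ x∈ds → All.lookup b#bs (ds⊆bs x∈ds)

  InColl⇒Descending : ∀ {μ} → InColl Z μ →
                      Σ ℕ λ n → Σ (List (Block Z)) λ ds → Descending n ds × μ ≗ Σblocks ds
  InColl⇒Descending (bs , disjoint , μ≗bs) with sortBlocks bs disjoint
  ... | n , ds , d , ds≗bs , _ = n , ds , d , λ j → trans (μ≗bs j) (sym (ds≗bs j))

module Evaluation (Z : ZList) (H : ℕ → ℕ) (fund : IsFundSeq Z H) where
  open WeightedSums H
  open Blocks Z
  open DescendingBlocks Z

  H-rec : ∀ m → 1 ≤ m → H (suc m) ≡ suc (sumTo m (θ m) H)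
  H-rec m m≥1 = proj₂ fund (suc m) (s≤s m≥1)

  H-pos : ∀ n → 1 ≤ n → 1 ≤ H n
  H-pos (suc zero)    _ = ≤-reflexive (sym (proj₁ fund))
  H-pos (suc (suc n)) _ rewrite H-rec (suc n) (s≤s z≤n) = s≤s z≤n

  H-step : ∀ m → 1 ≤ m → H m < H (suc m)
  H-step m m≥1 rewrite H-rec m m≥1 = s≤s (begin
    H m                ≡⟨ *-identityˡ (H m) ⟨
    1 * H m            ≤⟨ *-monoˡ-≤ (H m) (subst (1 ≤_) (sym (θ-top m≥1)) (n≢0⇒n>0 (e₁≢0 Z))) ⟩
    θ m m * H m        ≤⟨ term≤sumTo m (θ m) m≥1 ≤-refl ⟩
    sumTo m (θ m) H    ∎)
    where open ≤-Reasoning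

  H-mono : ∀ {a b} → 1 ≤ a → a ≤ b → H a ≤ H b
  H-mono {b = zero}  a≥1 a≤0 = ⊥-elim (<⇒≱ a≥1 a≤0)
  H-mono {b = suc b} a≥1 a≤1+b with m≤n⇒m<n∨m≡n a≤1+b
  ... | inj₂ refl      = ≤-refl
  ... | inj₁ (s≤s a≤b) = ≤-trans (H-mono a≥1 a≤b) (<⇒≤ (H-step b (≤-trans a≥1 a≤b)))

  sumTo-dominated< : ∀ {B l} {ζ ε μ : Coef} → Dominated ζ l μ → 1 ≤ l → l ≤ B →
                     sumTo B ε H < H l → sumTo B (λ j → ζ j + ε j) H < sumTo B μ H
  sumTo-dominated< {B} {l} {ζ} {ε} {μ} (ζ≤μ , ζl<μl) l≥1 l≤B ε<Hl = begin-strict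
    sumTo B (λ j → ζ j + ε j) H  ≡⟨ sumTo-+ B ζ ε ⟩
    sumTo B ζ H + sumTo B ε H    <⟨ +-monoʳ-< (sumTo B ζ H) ε<Hl ⟩
    sumTo B ζ H + H l            ≤⟨ sumTo-+H≤ B l≥1 l≤B (λ j _ _ → ζ≤μ j) ζl<μl ⟩
    sumTo B μ H                  ∎
    where open ≤-Reasoning

  Descending-sum<H   : ∀ {p bs} → Descending (suc p) bs → sumTo p (Σblocks bs) H < H (suc p)
  Descending-sumTo<H : ∀ {l B bs} → Descending l bs → 1 ≤ l → l ≤ B →
                       sumTo B (Σblocks bs) H < H l
  block-sum<H        : ∀ {m l ζ bs} → IsBlock Z m l ζ → Descending l bs →
                       sumTo m (λ j → ζ j + Σblocks bs j) H < H (suc m)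

  Descending-sum<H {p} [] = begin-strict
    sumTo p (Σblocks []) H  ≡⟨ sumTo-zero p (λ _ _ _ → refl) ⟩
    0                       <⟨ H-pos (suc p) (s≤s z≤n) ⟩
    H (suc p)               ∎
    where open ≤-Reasoning
  Descending-sum<H {p} (cons {block m l ζ ib} {bs} (s≤s m≤p) b≢0 d) = begin-strict
    sumTo p (Σblocks (block m l ζ ib ∷ bs)) H
      ≡⟨ sumTo-truncate p _ m≤p (Descending-vanish (cons {b = block m l ζ ib} ≤-refl b≢0 d)) ⟩
    sumTo m (λ j → ζ j + Σblocks bs j) H  <⟨ block-sum<H ib d ⟩
    H (suc m)                             ≤⟨ H-mono (s≤s z≤n) (s≤s m≤p) ⟩
    H (suc p)                             ∎
    where open ≤-Reasoning

  Descending-sumTo<H {suc p} {B} {bs} d _ 1+p≤B = begin-strict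
    sumTo B (Σblocks bs) H  ≡⟨ sumTo-truncate B _ (≤-trans (n≤1+n p) 1+p≤B) (Descending-vanish d) ⟩
    sumTo p (Σblocks bs) H  <⟨ Descending-sum<H d ⟩
    H (suc p)               ∎
    where open ≤-Reasoning

  block-sum<H {m} {bs = bs} (maximal ζ m≥1 ζ≗θ) d = begin-strict
    sumTo m (λ j → ζ j + Σblocks bs j) H
      ≡⟨ sumTo-cong m (λ j j≥1 _ → trans (cong₂ _+_ (ζ≗θ j) (Descending-vanish d j j≥1)) (+-identityʳ _)) ⟩
    sumTo m (θ m) H         <⟨ n<1+n _ ⟩
    suc (sumTo m (θ m) H)   ≡⟨ H-rec m m≥1 ⟨
    H (suc m)               ∎
    where open ≤-Reasoning
  block-sum<H {m} {bs = bs} ib@(proper ζ k k≥1 k≤m _ ζk<θk _) d = begin-strict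
    sumTo m (λ j → ζ j + Σblocks bs j) H
      <⟨ sumTo-dominated< (block-dominated (θ-isBlock m≥1) ib k≥1 ζk<θk) k≥1 k≤m
                          (Descending-sumTo<H d k≥1 k≤m) ⟩
    sumTo m (θ m) H         <⟨ n<1+n _ ⟩
    suc (sumTo m (θ m) H)   ≡⟨ H-rec m m≥1 ⟨
    H (suc m)               ∎
    where
    open ≤-Reasoning
    m≥1 : 1 ≤ m
    m≥1 = block-idx≥1 ib

  sumTo-below-top< : ∀ {m m′ B ds} {μ : Coef} → Descending (suc m) ds → m < m′ → m′ ≤ B →
                     1 ≤ μ m′ → sumTo B (Σblocks ds) H < sumTo B μ H
  sumTo-below-top< {m} {m′} {B} {ds} {μ} d m<m′ m′≤B μm′≥1 = begin-strict
    sumTo B (Σblocks ds) H  <⟨ Descending-sumTo<H d (s≤s z≤n) (≤-trans m<m′ m′≤B) ⟩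
    H (suc m)               ≤⟨ H-mono (s≤s z≤n) m<m′ ⟩
    H m′                    ≡⟨ *-identityˡ (H m′) ⟨
    1 * H m′                ≤⟨ *-monoˡ-≤ (H m′) μm′≥1 ⟩
    μ m′ * H m′             ≤⟨ term≤sumTo B μ (≤-trans (s≤s z≤n) m<m′) m′≤B ⟩
    sumTo B μ H             ∎
    where open ≤-Reasoning

  Descending-mono : ∀ {n B ds es} → Descending n ds → Descending n es →
                    Σblocks ds <a Σblocks es → n ≤ suc B →
                    sumTo B (Σblocks ds) H < sumTo B (Σblocks es) H
  Descending-mono {B = B} [] de (k , k≥1 , es-k>0 , _) n≤1+B =
    sumTo-below-top< [] k≥1 k≤B es-k>0
    where
    k≤B : k ≤ B
    k≤B with k ≤? B
    ... | yes k≤B = k≤B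
    ... | no  k≰B = ⊥-elim (<⇒≱ es-k>0 (≤-reflexive (Descending-vanish de k (≤-trans n≤1+B (≰⇒> k≰B)))))
  Descending-mono (cons _ _ _) [] (_ , _ , ds-k<0 , _) _ = ⊥-elim (n≮0 ds-k<0)
  Descending-mono {B = B} (cons {block m l ζ ib} {ds} m<n ζm≥1 dd)
                          (cons {block m′ l′ ξ ib′} {es} m′<n ξm′≥1 de) ds<es n≤1+B
                  with <-cmp m m′
  ... | tri< m<m′ _ _ = sumTo-below-top< (cons {b = block m l ζ ib} ≤-refl ζm≥1 dd) m<m′
                          (≤-pred (≤-trans m′<n n≤1+B)) (≤-trans ξm′≥1 (m≤m+n _ _))
  ... | tri> _ _ m′<m = ⊥-elim (vanish-from⇒≮a es≡0 (≤-trans ζm≥1 (m≤m+n _ _)) ds<es)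
    where
    es≡0 : ∀ j → m ≤ j → ξ j + Σblocks es j ≡ 0
    es≡0 j m≤j = Descending-vanish (cons {b = block m′ l′ ξ ib′} ≤-refl ξm′≥1 de) j (≤-trans m′<m m≤j)
  ... | tri≈ _ refl _ with blocks-compare ib ib′
  ...   | inj₁ (refl , ζ≗ξ) = begin-strict
    sumTo B (λ j → ζ j + Σblocks ds j) H  ≡⟨ sumTo-+ B ζ _ ⟩
    sumTo B ζ H + sumTo B (Σblocks ds) H
      <⟨ +-monoʳ-< (sumTo B ζ H) (Descending-mono dd de (<a-cancelˡ-+ ζ≗ξ ds<es) l≤1+B) ⟩
    sumTo B ζ H + sumTo B (Σblocks es) H  ≡⟨ cong (_+ _) (sumTo-cong B (λ j _ _ → ζ≗ξ j)) ⟩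
    sumTo B ξ H + sumTo B (Σblocks es) H  ≡⟨ sumTo-+ B ξ _ ⟨
    sumTo B (λ j → ξ j + Σblocks es j) H  ∎
    where
    open ≤-Reasoning
    l≤1+B : l ≤ suc B
    l≤1+B = ≤-trans (block-lo≤idx ib) (≤-trans (n≤1+n m) (≤-trans m<n n≤1+B))
  ...   | inj₂ (inj₁ ζ≺ξ) =
    sumTo-dominated< (Dominated-+ʳ (Σblocks es) ζ≺ξ) (block-lo≥1 ib) l≤B
                     (Descending-sumTo<H dd (block-lo≥1 ib) l≤B)
    where
    l≤B : l ≤ B
    l≤B = ≤-trans (block-lo≤idx ib) (≤-pred (≤-trans m<n n≤1+B))
  ...   | inj₂ (inj₂ ξ≺ζ) = ⊥-elim (Dominated⇒≮a (Σblocks ds) ξ≺ζ (Descending-vanish de) ds<es)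

  wsum≡sumTo : (ε : FCoef) {B : ℕ} → bound ε ≤ B → wsum ε H ≡ sumTo B (fn ε) H
  wsum≡sumTo ε ε≤B = sym (sumTo-truncate _ (fn ε) ε≤B (vanish ε))

  wsum-cong : (ε μ : FCoef) → fn ε ≈c fn μ → wsum ε H ≡ wsum μ H
  wsum-cong ε μ ε≈μ = begin
    wsum ε H                ≡⟨ wsum≡sumTo ε (m≤m+n (bound ε) (bound μ)) ⟩
    sumTo B (fn ε) H        ≡⟨ sumTo-cong B (λ j j≥1 _ → ε≈μ j j≥1) ⟩
    sumTo B (fn μ) H        ≡⟨ wsum≡sumTo μ (m≤n+m (bound μ) (bound ε)) ⟨
    wsum μ H                ∎
    where
    open ≡-Reasoning
    B : ℕ
    B = bound ε + bound μ

  wsum-strictMono : (ε μ : FCoef) → InColl Z (fn ε) → InColl Z (fn μ) →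
                    fn ε <a fn μ → wsum ε H < wsum μ H
  wsum-strictMono ε μ ε∈ μ∈ ε<μ with InColl⇒Descending ε∈ | InColl⇒Descending μ∈
  ... | n₁ , ds , dd , ε≗ds | n₂ , es , de , μ≗es = begin-strict
    wsum ε H               ≡⟨ wsum≡sumTo ε (≤-trans (m≤m+n _ _) (m≤n+m _ n)) ⟩
    sumTo B (fn ε) H       ≡⟨ sumTo-cong B (λ j _ _ → ε≗ds j) ⟩
    sumTo B (Σblocks ds) H
      <⟨ Descending-mono (Descending-weaken (m≤m⊔n n₁ n₂) dd) (Descending-weaken (m≤n⊔m n₁ n₂) de)
                         (<a-resp-≗ ε≗ds μ≗es ε<μ) (≤-trans (m≤m+n n _) (n≤1+n B)) ⟩
    sumTo B (Σblocks es) H ≡⟨ sumTo-cong B (λ j _ _ → μ≗es j) ⟨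
    sumTo B (fn μ) H       ≡⟨ wsum≡sumTo μ (≤-trans (m≤n+m _ _) (m≤n+m _ n)) ⟨
    wsum μ H               ∎
    where
    open ≤-Reasoning
    n B : ℕ
    n = n₁ ⊔ n₂
    B = n + (bound ε + bound μ)

  wsum-<⇒<a : (ε μ : FCoef) → InColl Z (fn ε) → InColl Z (fn μ) →
              wsum ε H < wsum μ H → fn ε <a fn μ
  wsum-<⇒<a ε μ ε∈ μ∈ ε<μ with <a-trichotomy-finite ε μ
  ... | inj₁ ε<aμ        = ε<aμ
  ... | inj₂ (inj₁ ε≈μ)  = ⊥-elim (<-irrefl (wsum-cong ε μ ε≈μ) ε<μ)
  ... | inj₂ (inj₂ μ<aε) = ⊥-elim (<-asym ε<μ (wsum-strictMono μ ε μ∈ ε∈ μ<aε))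

  InR-transfer : ∀ {E : ZList} → (∀ μ → InColl E μ → InColl Z μ) →
                 (ν ν′ : FCoef) → InColl Z (fn ν) → InColl Z (fn ν′) →
                 (∀ (ε : FCoef) → InColl E (fn ε) → fn ε <a fn ν → fn ε <a fn ν′) →
                 ∀ {y} → InR E H (wsum ν H) y → InR E H (wsum ν′ H) y
  InR-transfer E⊆Z ν ν′ ν∈ ν′∈ below (ε , ε∈E , refl , ε<ν) =
    ε , ε∈E , refl , wsum-strictMono ε ν′ ε∈Z ν′∈ (below ε ε∈E (wsum-<⇒<a ε ν ε∈Z ν∈ ε<ν))
    where
    ε∈Z : InColl Z (fn ε)
    ε∈Z = E⊆Z (fn ε) ε∈E

<a-check⇔<a-bar : ∀ {E : ZList} {μ : Coef} (μc μb : FCoef) → IsCheck E μ (fn μc) → IsBar E (fn μc) (fn μb) →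
                  (ε : FCoef) → InColl E (fn ε) → (fn ε <a μ → fn ε <a fn μb) × (fn ε <a fn μb → fn ε <a μ)
<a-check⇔<a-bar {μ = μ} μc μb (_ , μc<μ , check-max) (_ , μc<μb , bar-min) ε ε∈E =
  (λ ε<μ → ≤a-<a-trans (check-max ε ε∈E ε<μ) μc<μb) , below-μ
  where
  below-μ : fn ε <a fn μb → fn ε <a μ
  below-μ ε<μb with <a-trichotomy-finite ε μc
  ... | inj₁ ε<μc        = <a-trans ε<μc μc<μ
  ... | inj₂ (inj₁ ε≈μc) = <a-respˡ-≈c ε≈μc μc<μ
  ... | inj₂ (inj₂ μc<ε) = ⊥-elim (<a-irrefl (≤a-<a-trans (bar-min ε ε∈E μc<ε) ε<μb))

lemma3p8 : (L L̃ : ZList) (H̃ : ℕ → ℕ) → IsFundSeq L̃ H̃ →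
    (∀ μ → InColl L μ → InColl L̃ μ) →
    Σ (ℕ → ℕ) (λ μ → InColl L̃ μ × ¬ InColl L μ) →
    (μ μc μb : FCoef) → InColl L̃ (fn μ) → NonZeroCoef (fn μ) →
    IsCheck L (fn μ) (fn μc) → IsBar L (fn μc) (fn μb) →
    ∀ y → (InR L H̃ (wsum μ H̃) y → InR L H̃ (wsum μb H̃) y)
    × (InR L H̃ (wsum μb H̃) y → InR L H̃ (wsum μ H̃) y)
lemma3p8 L L̃ H̃ fund ℰ⊆ℰ̃ _ μ μc μb μ∈ℰ̃ _ check bar y =
  InR-transfer ℰ⊆ℰ̃ μ μb μ∈ℰ̃ μb∈ℰ̃ (λ ε ε∈ℰ → proj₁ (<a-check⇔<a-bar μc μb check bar ε ε∈ℰ)) ,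
  InR-transfer ℰ⊆ℰ̃ μb μ μb∈ℰ̃ μ∈ℰ̃ (λ ε ε∈ℰ → proj₂ (<a-check⇔<a-bar μc μb check bar ε ε∈ℰ))
  where
  open Evaluation L̃ H̃ fund
  μb∈ℰ̃ : InColl L̃ (fn μb)
  μb∈ℰ̃ = ℰ⊆ℰ̃ (fn μb) (proj₁ bar)
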